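{- Let $n\geq 1$ and let $T^3_n$ be the semigraph with vertex set $\{v_1,\dots,v_{2n+1}\}$ and edge set $\{(v_1,v_{2i},v_{2i+1}) : 1\leq i\leq n\}$. Equivalently, its adjacency matrix $A=(a_{jk})$ is the symmetric $(2n+1)\times(2n+1)$ matrix with zero diagonal, $a_{1,2i}=a_{2i,1}=1$, $a_{1,2i+1}=a_{2i+1,1}=2$, $a_{2i,2i+1}=a_{2i+1,2i}=1$ for $1\leq i\leq n$, and all other entries $0$. Then the characteristic polynomial of $A$ is $\det(\lambda I-A)=(\lambda^2-1)^{n-1}\left(\lambda^3-(5n+1)\lambda-4n\right)$; that is, the spectrum of $A$ consists of $-1$ with multiplicity $n-1$, $1$ with multiplicity $n-1$, and the three roots $\lambda_1,\lambda_2,\lambda_3$ of $\lambda^3-(5n+1)\lambda-4n$, each with multiplicity one.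
   Context: A semigraph $G=(V,E)$ consists of a finite vertex set $V$ and a set $E$ of edges, each an ordered tuple $(u_1,\dots,u_k)$, $k\ge 2$, of distinct vertices, where any two edges share at most one vertex and $(u_1,\dots,u_k)$ is identified with $(u_k,\dots,u_1)$. For an edge $e=(u_1,\dots,u_k)$ and $u_i,u_j\in e$, $d_e(u_i,u_j)=|i-j|$. When every edge is a full edge (its two end vertices are end vertices of every edge containing them, as in $T^3_n$), the adjacency matrix $A$ is indexed by vertices with $a_{ij}=d_e(v_i,v_j)$ if $v_i,v_j$ lie in a common edge $e$ and $a_{ij}=0$ otherwise. The spectrum of the semigraph is the spectrum of $A$. -}

module Defs where

open import Data.Nat using (ℕ; zero; suc)
open import Data.Fin using (Fin; zero; suc; toℕ; punchIn)
open import Data.Integer using (ℤ; +_; -_; _+_; _-_; _*_; _^_)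
open import Data.Bool using (true; false)
open import Relation.Nullary.Decidable using (does)
open import Data.Fin using (_≟_)

Matrix : ℕ → Set
Matrix m = Fin m → Fin m → ℤ

sumFin : ∀ {m} → (Fin m → ℤ) → ℤ
sumFin {zero}  f = + 0
sumFin {suc m} f = f zero + sumFin (λ i → f (suc i))

sign : ℕ → ℤ
sign zero          = + 1
sign (suc zero)    = - (+ 1)
sign (suc (suc k)) = sign k

minor : ∀ {m} → Matrix (suc m) → Fin (suc m) → Matrix m
minor M j r c = M (suc r) (punchIn j c)

det : ∀ {m} → Matrix m → ℤ
det {zero}  M = + 1
det {suc m} M = sumFin (λ j → sign (toℕ j) * (M zero j * det (minor M j)))

idMat : ∀ {m} → Matrix m
idMat i j with does (i ≟ j)
... | true  = + 1
... | false = + 0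

charMat : ∀ {m} → ℤ → Matrix m → Matrix m
charMat x M i j = x * idMat i j - M i j

-- Entries of the adjacency matrix of T^3_n, with 0-based indices:
-- index 0 is v_1, index 2i-1 is v_{2i}, index 2i is v_{2i+1}.
firstRow : ℕ → ℤ
firstRow zero                = + 0
firstRow (suc zero)          = + 1
firstRow (suc (suc zero))    = + 2
firstRow (suc (suc (suc k))) = firstRow (suc k)

-- Entries among indices ≥ 1 (shifted by one): pairs (2i-2, 2i-1) i.e. (v_{2i}, v_{2i+1}) get 1.
pairEntry : ℕ → ℕ → ℤ
pairEntry zero (suc zero) = + 1
pairEntry (suc zero) zero = + 1
pairEntry (suc (suc j)) (suc (suc k)) = pairEntry j k
pairEntry _ _ = + 0

adjℕ : ℕ → ℕ → ℤ
adjℕ zero    k       = firstRow k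
adjℕ (suc j) zero    = firstRow (suc j)
adjℕ (suc j) (suc k) = pairEntry j k

T3adj : (n : ℕ) → Matrix (suc (n Data.Nat.+ n))
T3adj n i j = adjℕ (toℕ i) (toℕ j)

-- Write H for the characteristic matrix xI − A of T³ₙ and P for its lower-right block, the
-- characteristic matrix of n disjoint edges, so det P = (x² − 1)ⁿ. Expanding det H along the
-- row of v₁, the minors of v₂ and v₃ are multiples of det P one size down, while the minor of
-- any later vertex still contains the intact block of the edge (v₂, v₃), which splits off a factor
-- x² − 1 and leaves the corresponding minor for T³ₙ₋₁. This gives the recurrence
-- Gₙ₊₁ = (x² − 1)Gₙ − (5x + 4)(x² − 1)ⁿ for Gₙ = det H, solved by the claimed closed form.
module Submission where

open import Defs
open import Data.Nat using (ℕ; zero; suc; _≤_; _∸_)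
import Data.Nat as ℕ
open import Data.Nat.Properties using (+-suc)
open import Data.Fin using (Fin; toℕ; punchIn) renaming (zero to fzero; suc to fsuc)
open import Data.Integer using (ℤ; +_; -_; _+_; _-_; _*_; _^_)
open import Data.Integer.Properties
  using (*-identityʳ; *-zeroˡ; *-zeroʳ; *-distribˡ-+; +-assoc; +-identityˡ; +-identityʳ; pos-+; pos-*)
open import Data.Integer.Tactic.RingSolver using (solve-∀)
open import Data.Product using (_,_)
open import Relation.Binary.PropositionalEquality
  using (_≡_; refl; sym; trans; cong; cong₂; module ≡-Reasoning)

open ≡-Reasoning

sumℕ : ℕ → (ℕ → ℤ) → ℤ
sumℕ zero    g = + 0
sumℕ (suc m) g = g 0 + sumℕ m (λ j → g (suc j))

sumℕ-cong : ∀ m {g h : ℕ → ℤ} → (∀ j → g j ≡ h j) → sumℕ m g ≡ sumℕ m h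
sumℕ-cong zero    g≡h = refl
sumℕ-cong (suc m) g≡h = cong₂ _+_ (g≡h 0) (sumℕ-cong m (λ j → g≡h (suc j)))

sumℕ-zero : ∀ m {g : ℕ → ℤ} → (∀ j → g j ≡ + 0) → sumℕ m g ≡ + 0
sumℕ-zero zero    g≡0 = refl
sumℕ-zero (suc m) g≡0 = cong₂ _+_ (g≡0 0) (sumℕ-zero m (λ j → g≡0 (suc j)))

sumℕ-*ˡ : ∀ m c (g : ℕ → ℤ) → sumℕ m (λ j → c * g j) ≡ c * sumℕ m g
sumℕ-*ˡ zero    c g = sym (*-zeroʳ c)
sumℕ-*ˡ (suc m) c g = begin
  c * g 0 + sumℕ m (λ j → c * g (suc j))  ≡⟨ cong (λ t → c * g 0 + t) (sumℕ-*ˡ m c (λ j → g (suc j))) ⟩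
  c * g 0 + c * sumℕ m (λ j → g (suc j))  ≡⟨ sym (*-distribˡ-+ c _ _) ⟩
  c * sumℕ (suc m) g                      ∎

sumℕ-+ : ∀ k m (g : ℕ → ℤ) → sumℕ (k ℕ.+ m) g ≡ sumℕ k g + sumℕ m (λ j → g (k ℕ.+ j))
sumℕ-+ zero    m g = sym (+-identityˡ _)
sumℕ-+ (suc k) m g = begin
  g 0 + sumℕ (k ℕ.+ m) (λ j → g (suc j))
    ≡⟨ cong (λ t → g 0 + t) (sumℕ-+ k m (λ j → g (suc j))) ⟩
  g 0 + (sumℕ k (λ j → g (suc j)) + sumℕ m (λ j → g (suc k ℕ.+ j)))
    ≡⟨ sym (+-assoc (g 0) _ _) ⟩
  sumℕ (suc k) g + sumℕ m (λ j → g (suc k ℕ.+ j))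
    ∎

-- Matrices indexed by ℕ, with the size passed to the determinant, so that minors need no Fin arithmetic.

punchInℕ : ℕ → ℕ → ℕ
punchInℕ zero    c       = suc c
punchInℕ (suc j) zero    = zero
punchInℕ (suc j) (suc c) = suc (punchInℕ j c)

minorℕ : (ℕ → ℕ → ℤ) → ℕ → ℕ → ℕ → ℤ
minorℕ f j r c = f (suc r) (punchInℕ j c)

mutual
  detℕ : ℕ → (ℕ → ℕ → ℤ) → ℤ
  detℕ zero    f = + 1
  detℕ (suc m) f = sumℕ (suc m) (laplaceTerm m f)

  laplaceTerm : ℕ → (ℕ → ℕ → ℤ) → ℕ → ℤ
  laplaceTerm m f j = sign j * (f 0 j * detℕ m (minorℕ f j))

toℕ-punchIn : ∀ {m} (j : Fin (suc m)) (c : Fin m) → toℕ (punchIn j c) ≡ punchInℕ (toℕ j) (toℕ c)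
toℕ-punchIn fzero    c        = refl
toℕ-punchIn (fsuc j) fzero    = refl
toℕ-punchIn (fsuc j) (fsuc c) = cong suc (toℕ-punchIn j c)

sumFin-toℕ : ∀ m (F : Fin m → ℤ) (g : ℕ → ℤ) → (∀ j → F j ≡ g (toℕ j)) → sumFin F ≡ sumℕ m g
sumFin-toℕ zero    F g F≡g = refl
sumFin-toℕ (suc m) F g F≡g =
  cong₂ _+_ (F≡g fzero) (sumFin-toℕ m (λ j → F (fsuc j)) (λ j → g (suc j)) (λ j → F≡g (fsuc j)))

det-toℕ : ∀ m (M : Matrix m) f → (∀ i j → M i j ≡ f (toℕ i) (toℕ j)) → det M ≡ detℕ m f
det-toℕ zero    M f M≡f = refl
det-toℕ (suc m) M f M≡f = sumFin-toℕ (suc m) _ (laplaceTerm m f) λ j →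
  cong (λ t → sign (toℕ j) * t) (cong₂ _*_ (M≡f fzero j) (det-toℕ m (minor M j) (minorℕ f (toℕ j))
    λ r c → trans (M≡f (fsuc r) (punchIn j c)) (cong (f (suc (toℕ r))) (toℕ-punchIn j c))))

detℕ-cong : ∀ m {f g : ℕ → ℕ → ℤ} → (∀ i j → f i j ≡ g i j) → detℕ m f ≡ detℕ m g
detℕ-cong zero    f≡g = refl
detℕ-cong (suc m) f≡g = sumℕ-cong (suc m) λ j →
  cong₂ (λ a d → sign j * (a * d)) (f≡g 0 j) (detℕ-cong m (λ r c → f≡g (suc r) (punchInℕ j c)))

laplaceTerm-zeroEntry : ∀ m f j → f 0 j ≡ + 0 → laplaceTerm m f j ≡ + 0
laplaceTerm-zeroEntry m f j entry≡0 = begin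
  sign j * (f 0 j * detℕ m (minorℕ f j))  ≡⟨ cong (λ a → sign j * (a * detℕ m (minorℕ f j))) entry≡0 ⟩
  sign j * (+ 0 * detℕ m (minorℕ f j))    ≡⟨ cong (sign j *_) (*-zeroˡ (detℕ m (minorℕ f j))) ⟩
  sign j * + 0                            ≡⟨ *-zeroʳ (sign j) ⟩
  + 0                                     ∎

laplaceTerm-zeroMinor : ∀ m f j → detℕ m (minorℕ f j) ≡ + 0 → laplaceTerm m f j ≡ + 0
laplaceTerm-zeroMinor m f j minor≡0 = begin
  sign j * (f 0 j * detℕ m (minorℕ f j))  ≡⟨ cong (λ d → sign j * (f 0 j * d)) minor≡0 ⟩
  sign j * (f 0 j * + 0)                  ≡⟨ cong (sign j *_) (*-zeroʳ (f 0 j)) ⟩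
  sign j * + 0                            ≡⟨ *-zeroʳ (sign j) ⟩
  + 0                                     ∎

detℕ-zeroColumn : ∀ m f → (∀ r → f r 0 ≡ + 0) → detℕ (suc m) f ≡ + 0
detℕ-zeroColumn zero    f col≡0 = cong (_+ + 0) (laplaceTerm-zeroEntry 0 f 0 (col≡0 0))
detℕ-zeroColumn (suc m) f col≡0 = sumℕ-zero (suc (suc m)) {laplaceTerm (suc m) f} λ where
  zero    → laplaceTerm-zeroEntry (suc m) f 0 (col≡0 0)
  (suc j) → laplaceTerm-zeroMinor (suc m) f (suc j)
              (detℕ-zeroColumn m (minorℕ f (suc j)) (λ r → col≡0 (suc r)))

-- Below row 0 the first two columns vanish, so they are linearly dependent.
detℕ-zeroColumns₀₁ : ∀ m f → (∀ r → f (suc r) 0 ≡ + 0) → (∀ r → f (suc r) 1 ≡ + 0) →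
  detℕ (suc (suc m)) f ≡ + 0
detℕ-zeroColumns₀₁ m f col₀≡0 col₁≡0 = sumℕ-zero (suc (suc m)) {laplaceTerm (suc m) f} λ where
  zero    → laplaceTerm-zeroMinor (suc m) f 0 (detℕ-zeroColumn m (minorℕ f 0) col₁≡0)
  (suc j) → laplaceTerm-zeroMinor (suc m) f (suc j) (detℕ-zeroColumn m (minorℕ f (suc j)) col₀≡0)

detℕ-rowSupport : ∀ k m f → (∀ c → f 0 (suc k ℕ.+ c) ≡ + 0) →
  detℕ (suc k ℕ.+ m) f ≡ sumℕ (suc k) (laplaceTerm (k ℕ.+ m) f)
detℕ-rowSupport k m f row≡0 = begin
  sumℕ (suc k ℕ.+ m) term
    ≡⟨ sumℕ-+ (suc k) m term ⟩
  sumℕ (suc k) term + sumℕ m (λ c → term (suc k ℕ.+ c))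
    ≡⟨ cong (λ t → sumℕ (suc k) term + t)
            (sumℕ-zero m λ c → laplaceTerm-zeroEntry (k ℕ.+ m) f (suc k ℕ.+ c) (row≡0 c)) ⟩
  sumℕ (suc k) term + + 0
    ≡⟨ +-identityʳ _ ⟩
  sumℕ (suc k) term
    ∎
  where
  term = laplaceTerm (k ℕ.+ m) f

detℕ-rowSupport₁ : ∀ m f → (∀ c → f 0 (1 ℕ.+ c) ≡ + 0) →
  detℕ (suc m) f ≡ f 0 0 * detℕ m (minorℕ f 0)
detℕ-rowSupport₁ m f row≡0 =
  trans (detℕ-rowSupport 0 m f row≡0) (expansion (f 0 0) (detℕ m (minorℕ f 0)))
  where
  expansion : ∀ a d → + 1 * (a * d) + + 0 ≡ a * d
  expansion = solve-∀

detℕ-rowSupport₂ : ∀ m f → (∀ c → f 0 (2 ℕ.+ c) ≡ + 0) →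
  detℕ (2 ℕ.+ m) f ≡ f 0 0 * detℕ (suc m) (minorℕ f 0) - f 0 1 * detℕ (suc m) (minorℕ f 1)
detℕ-rowSupport₂ m f row≡0 = trans (detℕ-rowSupport 1 m f row≡0)
  (expansion (f 0 0) (detℕ (suc m) (minorℕ f 0)) (f 0 1) (detℕ (suc m) (minorℕ f 1)))
  where
  expansion : ∀ a d b e → + 1 * (a * d) + (- + 1 * (b * e) + + 0) ≡ a * d - b * e
  expansion = solve-∀

detℕ-rowSupport₃ : ∀ m f → (∀ c → f 0 (3 ℕ.+ c) ≡ + 0) →
  detℕ (3 ℕ.+ m) f ≡ f 0 0 * detℕ (2 ℕ.+ m) (minorℕ f 0) - f 0 1 * detℕ (2 ℕ.+ m) (minorℕ f 1)
                       + f 0 2 * detℕ (2 ℕ.+ m) (minorℕ f 2)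
detℕ-rowSupport₃ m f row≡0 = trans (detℕ-rowSupport 2 m f row≡0)
  (expansion (f 0 0) (detℕ (2 ℕ.+ m) (minorℕ f 0)) (f 0 1) (detℕ (2 ℕ.+ m) (minorℕ f 1))
             (f 0 2) (detℕ (2 ℕ.+ m) (minorℕ f 2)))
  where
  expansion : ∀ a d b e c g →
    + 1 * (a * d) + (- + 1 * (b * e) + (+ 1 * (c * g) + + 0)) ≡ a * d - b * e + c * g
  expansion = solve-∀

idℕ : ℕ → ℕ → ℤ
idℕ zero    zero    = + 1
idℕ zero    (suc b) = + 0
idℕ (suc a) zero    = + 0
idℕ (suc a) (suc b) = idℕ a b

idMat-toℕ : ∀ {m} (i j : Fin m) → idMat i j ≡ idℕ (toℕ i) (toℕ j)
idMat-toℕ fzero    fzero    = refl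
idMat-toℕ fzero    (fsuc j) = refl
idMat-toℕ (fsuc i) fzero    = refl
idMat-toℕ (fsuc i) (fsuc j) = idMat-toℕ i j

-- The matrices xI − A written out by cases, so that entries of iterated minors compute.
pairChar : ℤ → ℕ → ℕ → ℤ
pairChar x 0             0             = x
pairChar x 0             1             = - + 1
pairChar x 0             (suc (suc c)) = + 0
pairChar x 1             0             = - + 1
pairChar x 1             1             = x
pairChar x 1             (suc (suc c)) = + 0
pairChar x (suc (suc r)) 0             = + 0
pairChar x (suc (suc r)) 1             = + 0
pairChar x (suc (suc r)) (suc (suc c)) = pairChar x r c

T3char : ℤ → ℕ → ℕ → ℤ
T3char x 0       0       = x
T3char x 0       (suc c) = - firstRow (suc c)
T3char x (suc r) 0       = - firstRow (suc r)
T3char x (suc r) (suc c) = pairChar x r c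

char-diagonal : ∀ x → x ≡ x * + 1 - + 0
char-diagonal = solve-∀

char-offDiagonal : ∀ x a → - a ≡ x * + 0 - a
char-offDiagonal = solve-∀

pairChar-entry : ∀ x r c → pairChar x r c ≡ x * idℕ r c - pairEntry r c
pairChar-entry x 0             0             = char-diagonal x
pairChar-entry x 0             1             = char-offDiagonal x (+ 1)
pairChar-entry x 0             (suc (suc c)) = char-offDiagonal x (+ 0)
pairChar-entry x 1             0             = char-offDiagonal x (+ 1)
pairChar-entry x 1             1             = char-diagonal x
pairChar-entry x 1             (suc (suc c)) = char-offDiagonal x (+ 0)
pairChar-entry x (suc (suc r)) 0             = char-offDiagonal x (+ 0)
pairChar-entry x (suc (suc r)) 1             = char-offDiagonal x (+ 0)
pairChar-entry x (suc (suc r)) (suc (suc c)) = pairChar-entry x r c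

T3char-entry : ∀ x r c → T3char x r c ≡ x * idℕ r c - adjℕ r c
T3char-entry x 0       0       = char-diagonal x
T3char-entry x 0       (suc c) = char-offDiagonal x (firstRow (suc c))
T3char-entry x (suc r) 0       = char-offDiagonal x (firstRow (suc r))
T3char-entry x (suc r) (suc c) = pairChar-entry x r c

det-charMat-T3adj : ∀ n x → det (charMat x (T3adj n)) ≡ detℕ (suc (n ℕ.+ n)) (T3char x)
det-charMat-T3adj n x = det-toℕ (suc (n ℕ.+ n)) (charMat x (T3adj n)) (T3char x) λ i j →
  trans (cong (λ e → x * e - adjℕ (toℕ i) (toℕ j)) (idMat-toℕ i j))
        (sym (T3char-entry x (toℕ i) (toℕ j)))

edgeCharPoly : ℤ → ℤ
edgeCharPoly x = x * x - + 1

det-pairChar-step : ∀ x m → detℕ (2 ℕ.+ m) (pairChar x) ≡ edgeCharPoly x * detℕ m (pairChar x)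
det-pairChar-step x m = begin
  detℕ (2 ℕ.+ m) P
    ≡⟨ detℕ-rowSupport₂ m P (λ c → refl) ⟩
  x * detℕ (suc m) (minorℕ P 0) - - + 1 * detℕ (suc m) (minorℕ P 1)
    ≡⟨ cong₂ (λ a b → x * a - - + 1 * b) (detℕ-rowSupport₁ m (minorℕ P 0) (λ c → refl))
                                           (detℕ-rowSupport₁ m (minorℕ P 1) (λ c → refl)) ⟩
  x * (x * detℕ m P) - - + 1 * (- + 1 * detℕ m P)
    ≡⟨ expansion x (detℕ m P) ⟩
  edgeCharPoly x * detℕ m P
    ∎
  where
  P = pairChar x
  expansion : ∀ x K → x * (x * K) - - + 1 * (- + 1 * K) ≡ (x * x - + 1) * K
  expansion = solve-∀

det-pairChar : ∀ x k → detℕ (k ℕ.+ k) (pairChar x) ≡ edgeCharPoly x ^ k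
det-pairChar x zero    = refl
det-pairChar x (suc k) = begin
  detℕ (suc k ℕ.+ suc k) (pairChar x)  ≡⟨ cong (λ m → detℕ (suc m) (pairChar x)) (+-suc k k) ⟩
  detℕ (2 ℕ.+ (k ℕ.+ k)) (pairChar x)  ≡⟨ det-pairChar-step x (k ℕ.+ k) ⟩
  edgeCharPoly x * detℕ (k ℕ.+ k) (pairChar x) ≡⟨ cong (edgeCharPoly x *_) (det-pairChar x k) ⟩
  edgeCharPoly x ^ suc k               ∎

det-T3char-minor₁ : ∀ x k → detℕ (2 ℕ.+ k) (minorℕ (T3char x) 1) ≡ - (x + + 2) * detℕ k (pairChar x)
det-T3char-minor₁ x k = begin
  detℕ (2 ℕ.+ k) M
    ≡⟨ detℕ-rowSupport₂ k M (λ c → refl) ⟩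
  - + 1 * detℕ (suc k) (minorℕ M 0) - - + 1 * detℕ (suc k) (minorℕ M 1)
    ≡⟨ cong₂ (λ a b → - + 1 * a - - + 1 * b) (detℕ-rowSupport₁ k (minorℕ M 0) (λ c → refl))
                                               (detℕ-rowSupport₁ k (minorℕ M 1) (λ c → refl)) ⟩
  - + 1 * (x * detℕ k (pairChar x)) - - + 1 * (- + 2 * detℕ k (pairChar x))
    ≡⟨ expansion x (detℕ k (pairChar x)) ⟩
  - (x + + 2) * detℕ k (pairChar x)
    ∎
  where
  M = minorℕ (T3char x) 1
  expansion : ∀ x K → - + 1 * (x * K) - - + 1 * (- + 2 * K) ≡ - (x + + 2) * K
  expansion = solve-∀

det-T3char-minor₂ : ∀ x k → detℕ (2 ℕ.+ k) (minorℕ (T3char x) 2) ≡ (+ 2 * x + + 1) * detℕ k (pairChar x)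
det-T3char-minor₂ x k = begin
  detℕ (2 ℕ.+ k) M
    ≡⟨ detℕ-rowSupport₂ k M (λ c → refl) ⟩
  - + 1 * detℕ (suc k) (minorℕ M 0) - x * detℕ (suc k) (minorℕ M 1)
    ≡⟨ cong₂ (λ a b → - + 1 * a - x * b) (detℕ-rowSupport₁ k (minorℕ M 0) (λ c → refl))
                                           (detℕ-rowSupport₁ k (minorℕ M 1) (λ c → refl)) ⟩
  - + 1 * (- + 1 * detℕ k (pairChar x)) - x * (- + 2 * detℕ k (pairChar x))
    ≡⟨ expansion x (detℕ k (pairChar x)) ⟩
  (+ 2 * x + + 1) * detℕ k (pairChar x)
    ∎
  where
  M = minorℕ (T3char x) 2
  expansion : ∀ x K → - + 1 * (- + 1 * K) - x * (- + 2 * K) ≡ (+ 2 * x + + 1) * K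
  expansion = solve-∀

-- Rows 1 and 2 of the minor meet only columns 0, 1 and 2, and expanding along them removes the
-- block of the edge (v₂, v₃).
det-T3char-minor-step : ∀ x k j →
  detℕ (3 ℕ.+ k) (minorℕ (T3char x) (3 ℕ.+ j)) ≡ edgeCharPoly x * detℕ (suc k) (minorℕ (T3char x) (suc j))
det-T3char-minor-step x k j = begin
  detℕ (3 ℕ.+ k) M
    ≡⟨ detℕ-rowSupport₃ k M (λ c → refl) ⟩
  - + 1 * detℕ (2 ℕ.+ k) (minorℕ M 0) - x * detℕ (2 ℕ.+ k) (minorℕ M 1)
    + - + 1 * detℕ (2 ℕ.+ k) (minorℕ M 2)
    ≡⟨ cong₂ (λ a (b , c) → - + 1 * a - x * b + - + 1 * c)
             (detℕ-zeroColumns₀₁ k (minorℕ M 0) (λ r → refl) (λ r → refl)) (cong₂ _,_ minor₁ minor₂) ⟩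
  - + 1 * + 0 - x * (- + 2 * + 0 - x * K) + - + 1 * (- + 2 * + 0 - - + 1 * K)
    ≡⟨ expansion x K ⟩
  edgeCharPoly x * K
    ∎
  where
  H = T3char x
  M = minorℕ H (3 ℕ.+ j)
  K = detℕ (suc k) (minorℕ H (suc j))

  minor₁₁ : ∀ r c → minorℕ (minorℕ M 1) 1 r c ≡ minorℕ H (suc j) r c
  minor₁₁ r zero    = refl
  minor₁₁ r (suc c) = refl

  minor₂₁ : ∀ r c → minorℕ (minorℕ M 2) 1 r c ≡ minorℕ H (suc j) r c
  minor₂₁ r zero    = refl
  minor₂₁ r (suc c) = refl

  minor₁ : detℕ (2 ℕ.+ k) (minorℕ M 1) ≡ - + 2 * + 0 - x * K
  minor₁ = trans (detℕ-rowSupport₂ k (minorℕ M 1) (λ c → refl))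
    (cong₂ (λ a b → - + 2 * a - x * b) (detℕ-zeroColumn k (minorℕ (minorℕ M 1) 0) (λ r → refl))
                                       (detℕ-cong (suc k) minor₁₁))

  minor₂ : detℕ (2 ℕ.+ k) (minorℕ M 2) ≡ - + 2 * + 0 - - + 1 * K
  minor₂ = trans (detℕ-rowSupport₂ k (minorℕ M 2) (λ c → refl))
    (cong₂ (λ a b → - + 2 * a - - + 1 * b) (detℕ-zeroColumn k (minorℕ (minorℕ M 2) 0) (λ r → refl))
                                           (detℕ-cong (suc k) minor₂₁))

  expansion : ∀ x K → - + 1 * + 0 - x * (- + 2 * + 0 - x * K) + - + 1 * (- + 2 * + 0 - - + 1 * K)
                      ≡ (x * x - + 1) * K
  expansion = solve-∀

T3tail : ℤ → ℕ → ℤ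
T3tail x k = sumℕ k (λ j → laplaceTerm k (T3char x) (suc j))

T3tail-step : ∀ x k →
  sumℕ k (λ j → laplaceTerm (2 ℕ.+ k) (T3char x) (3 ℕ.+ j)) ≡ edgeCharPoly x * T3tail x k
T3tail-step x zero    = sym (*-zeroʳ (edgeCharPoly x))
T3tail-step x (suc k) = trans (sumℕ-cong (suc k) term-step)
                              (sumℕ-*ˡ (suc k) (edgeCharPoly x) (λ j → laplaceTerm (suc k) H (suc j)))
  where
  H = T3char x
  term-step : ∀ j → laplaceTerm (3 ℕ.+ k) H (3 ℕ.+ j) ≡ edgeCharPoly x * laplaceTerm (suc k) H (suc j)
  term-step j = trans (cong (λ d → sign (suc j) * (H 0 (suc j) * d)) (det-T3char-minor-step x k j))
    (rearrange (sign (suc j)) (H 0 (suc j)) (edgeCharPoly x) (detℕ (suc k) (minorℕ H (suc j))))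
    where
    rearrange : ∀ s a c d → s * (a * (c * d)) ≡ c * (s * (a * d))
    rearrange = solve-∀

det-T3char-step : ∀ x k →
  detℕ (3 ℕ.+ k) (T3char x) ≡ edgeCharPoly x * detℕ (suc k) (T3char x) - (+ 5 * x + + 4) * detℕ k (pairChar x)
det-T3char-step x k = begin
  detℕ (3 ℕ.+ k) H
    ≡⟨⟩
  + 1 * (x * detℕ (2 ℕ.+ k) P) + (- + 1 * (- + 1 * detℕ (2 ℕ.+ k) (minorℕ H 1))
    + (+ 1 * (- + 2 * detℕ (2 ℕ.+ k) (minorℕ H 2)) + sumℕ k (λ j → laplaceTerm (2 ℕ.+ k) H (3 ℕ.+ j))))
    ≡⟨ cong₂ (λ a b → + 1 * (x * a) + b) (det-pairChar-step x k)
         (cong₂ (λ c d → - + 1 * (- + 1 * c) + d) (det-T3char-minor₁ x k)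
           (cong₂ (λ e t → + 1 * (- + 2 * e) + t) (det-T3char-minor₂ x k) (T3tail-step x k))) ⟩
  + 1 * (x * ((x * x - + 1) * K)) + (- + 1 * (- + 1 * (- (x + + 2) * K))
    + (+ 1 * (- + 2 * ((+ 2 * x + + 1) * K)) + (x * x - + 1) * T3tail x k))
    ≡⟨ expansion x K (T3tail x k) ⟩
  edgeCharPoly x * detℕ (suc k) H - (+ 5 * x + + 4) * K
    ∎
  where
  H = T3char x
  P = pairChar x
  K = detℕ k P
  expansion : ∀ x K T →
    + 1 * (x * ((x * x - + 1) * K)) + (- + 1 * (- + 1 * (- (x + + 2) * K))
      + (+ 1 * (- + 2 * ((+ 2 * x + + 1) * K)) + (x * x - + 1) * T))
    ≡ (x * x - + 1) * (+ 1 * (x * K) + T) - (+ 5 * x + + 4) * K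
  expansion = solve-∀

det-T3char-recurrence : ∀ x n →
  detℕ (suc (suc n ℕ.+ suc n)) (T3char x)
    ≡ edgeCharPoly x * detℕ (suc (n ℕ.+ n)) (T3char x) - (+ 5 * x + + 4) * edgeCharPoly x ^ n
det-T3char-recurrence x n = begin
  detℕ (suc (suc n ℕ.+ suc n)) (T3char x)
    ≡⟨ cong (λ m → detℕ (2 ℕ.+ m) (T3char x)) (+-suc n n) ⟩
  detℕ (3 ℕ.+ (n ℕ.+ n)) (T3char x)
    ≡⟨ det-T3char-step x (n ℕ.+ n) ⟩
  edgeCharPoly x * detℕ (suc (n ℕ.+ n)) (T3char x) - (+ 5 * x + + 4) * detℕ (n ℕ.+ n) (pairChar x)
    ≡⟨ cong (λ d → edgeCharPoly x * detℕ (suc (n ℕ.+ n)) (T3char x) - (+ 5 * x + + 4) * d)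
            (det-pairChar x n) ⟩
  edgeCharPoly x * detℕ (suc (n ℕ.+ n)) (T3char x) - (+ 5 * x + + 4) * edgeCharPoly x ^ n
    ∎

T3cubic : ℕ → ℤ → ℤ
T3cubic m x = x * x * x - (+ 5 * + m + + 1) * x - + 4 * + m

det-T3char : ∀ x n → detℕ (suc (suc n ℕ.+ suc n)) (T3char x) ≡ edgeCharPoly x ^ n * T3cubic (suc n) x
det-T3char x zero = trans (det-T3char-recurrence x 0) (expansion x)
  where
  expansion : ∀ x → (x * x - + 1) * (+ 1 * (x * + 1) + + 0) - (+ 5 * x + + 4) * + 1
                    ≡ + 1 * (x * x * x - (+ 5 * + 1 + + 1) * x - + 4 * + 1)
  expansion = solve-∀
det-T3char x (suc n) = begin
  detℕ (suc (suc (suc n) ℕ.+ suc (suc n))) (T3char x)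
    ≡⟨ det-T3char-recurrence x (suc n) ⟩
  edgeCharPoly x * detℕ (suc (suc n ℕ.+ suc n)) (T3char x) - (+ 5 * x + + 4) * edgeCharPoly x ^ suc n
    ≡⟨ cong (λ g → edgeCharPoly x * g - (+ 5 * x + + 4) * edgeCharPoly x ^ suc n) (det-T3char x n) ⟩
  edgeCharPoly x * (edgeCharPoly x ^ n * T3cubic (suc n) x) - (+ 5 * x + + 4) * edgeCharPoly x ^ suc n
    ≡⟨ expansion x (edgeCharPoly x) (edgeCharPoly x ^ n) (+ suc n) ⟩
  edgeCharPoly x ^ suc n * T3cubic (suc (suc n)) x
    ∎
  where
  expansion : ∀ x d e m →
    d * (e * (x * x * x - (+ 5 * m + + 1) * x - + 4 * m)) - (+ 5 * x + + 4) * (d * e)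
      ≡ d * e * (x * x * x - (+ 5 * (+ 1 + m) + + 1) * x - + 4 * (+ 1 + m))
  expansion = solve-∀

edgeCharPoly-^ : ∀ x → edgeCharPoly x ≡ x ^ 2 - + 1
edgeCharPoly-^ x = cong (λ y → x * y - + 1) (sym (*-identityʳ x))

T3cubic-^ : ∀ m x → T3cubic m x ≡ x ^ 3 - + (5 ℕ.* m ℕ.+ 1) * x - + (4 ℕ.* m)
T3cubic-^ m x = begin
  x * x * x - (+ 5 * + m + + 1) * x - + 4 * + m
    ≡⟨ cube x (+ 5 * + m + + 1) (+ 4 * + m) ⟩
  x ^ 3 - (+ 5 * + m + + 1) * x - + 4 * + m
    ≡⟨ cong₂ (λ a b → x ^ 3 - a * x - b) (sym (trans (pos-+ (5 ℕ.* m) 1) (cong (_+ + 1) (pos-* 5 m))))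
                                         (sym (pos-* 4 m)) ⟩
  x ^ 3 - + (5 ℕ.* m ℕ.+ 1) * x - + (4 ℕ.* m)
    ∎
  where
  cube : ∀ x a b → x * x * x - a * x - b ≡ x * (x * (x * + 1)) - a * x - b
  cube = solve-∀

lemma1 : (n : ℕ) → 1 ≤ n → (x : ℤ) →
    det (charMat x (T3adj n))
    ≡ ((x ^ 2) - + 1) ^ (n ∸ 1) * ((x ^ 3) - (+ (5 Data.Nat.* n Data.Nat.+ 1)) * x - + (4 Data.Nat.* n))
lemma1 (suc n) _ x = begin
  det (charMat x (T3adj (suc n)))
    ≡⟨ det-charMat-T3adj (suc n) x ⟩
  detℕ (suc (suc n ℕ.+ suc n)) (T3char x)
    ≡⟨ det-T3char x n ⟩
  edgeCharPoly x ^ n * T3cubic (suc n) x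
    ≡⟨ cong₂ (λ d c → d ^ n * c) (edgeCharPoly-^ x) (T3cubic-^ (suc n) x) ⟩
  (x ^ 2 - + 1) ^ n * (x ^ 3 - + (5 ℕ.* suc n ℕ.+ 1) * x - + (4 ℕ.* suc n))
    ∎
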